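{- Let $G$ be a connected graph with at least two vertices. Then $\hom(G_2,Y(G))>\hom(G_2,\tilde Y(G))$.
   Context: All graphs are finite, simple and undirected. $\hom(F,H)$ is the number of homomorphisms (edge-preserving maps $V(F)\to V(H)$) from $F$ to $H$. The 2-subdivision $G_2$ of $G$ is obtained by replacing every edge $uv$ of $G$ by a path $u,w_{u,v},w_{v,u},v$ with two new vertices. For each vertex $u$ of $G$ let $A(u)=\{a(u,v): uv\in E(G)\}$ and $B(u)=\{b(u,v): uv\in E(G)\}$ be sets of new pairwise distinct elements, and let $M(u)$ be the set of all subsets of $A(u)$ of even cardinality, each regarded as a new vertex. The gadget $Y(u)$ has vertex set $A(u)\cup B(u)\cup M(u)$ and, for $m\in M(u)$, the edge $\{a(u,v),m\}$ if $a(u,v)\in m$ and the edge $\{b(u,v),m\}$ if $a(u,v)\notin m$. $Y(G)$ is the disjoint union of all gadgets $Y(u)$ together with, for each edge $uv\in E(G)$, the edges $\{a(u,v),a(v,u)\}$ and $\{b(u,v),b(v,u)\}$. $\tilde Y(G)$ is obtained from $Y(G)$ by choosing one edge $u_0v_0$ of $G$ and replacing $\{a(u_0,v_0),a(v_0,u_0)\}$, $\{b(u_0,v_0),b(v_0,u_0)\}$ by $\{a(u_0,v_0),b(v_0,u_0)\}$, $\{b(u_0,v_0),a(v_0,u_0)\}$ (up to isomorphism independent of the chosen edge). -}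

module Defs where

open import Data.Bool using (Bool; true; false; T; _∧_; _∨_; not)
open import Data.Nat using (ℕ; zero; suc)
open import Data.Fin using (Fin; _≟_)
open import Data.Fin.Subset using (Subset; ∣_∣)
open import Data.List using (List; []; _∷_; _++_; map; concatMap; filterᵇ; length; allFin; foldr; [_])
open import Data.Vec using (Vec; lookup) renaming ([] to []ᵥ; _∷_ to _∷ᵥ_)
open import Data.Product using (_×_; _,_)
open import Relation.Nullary using (Dec; yes; no)
open import Relation.Nullary.Decidable using (⌊_⌋; T?)

-- A finite graph: a vertex type V, a list `verts` enumerating V
-- (each vertex exactly once), and a Boolean adjacency relation.
record Graph : Set₁ where
  field
    V     : Set
    verts : List V
    adj   : V → V → Bool

-- All maps from the listed domain `xs` to the listed codomain `ys`,
-- each map represented by its graph [(x₁ , f x₁) , … , (xₖ , f xₖ)].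
maps : {A B : Set} → List A → List B → List (List (A × B))
maps []       ys = [ [] ]
maps (x ∷ xs) ys = concatMap (λ y → map ((x , y) ∷_) (maps xs ys)) ys

allᵇ : {A : Set} → (A → Bool) → List A → Bool
allᵇ p = foldr (λ x r → p x ∧ r) true

isHom : {A B : Set} → (A → A → Bool) → (B → B → Bool) → List (A × B) → Bool
isHom adjF adjH g =
  allᵇ (λ { (x , fx) → allᵇ (λ { (y , fy) → not (adjF x y) ∨ adjH fx fy }) g }) g

hom : Graph → Graph → ℕ
hom F H = length (filterᵇ (isHom (Graph.adj F) (Graph.adj H))
                          (maps (Graph.verts F) (Graph.verts H)))

_==_ : {n : ℕ} → Fin n → Fin n → Bool
u == v = ⌊ u ≟ v ⌋

data Reach {n : ℕ} (adj : Fin n → Fin n → Bool) : Fin n → Fin n → Set where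
  here : ∀ {u} → Reach adj u u
  step : ∀ {u w v} → T (adj u w) → Reach adj w v → Reach adj u v

Connected : (n : ℕ) → (Fin n → Fin n → Bool) → Set
Connected n adj = (u v : Fin n) → Reach adj u v

allVecsBool : (n : ℕ) → List (Vec Bool n)
allVecsBool zero    = [ []ᵥ ]
allVecsBool (suc n) = concatMap (λ b → map (b ∷ᵥ_) (allVecsBool n)) (true ∷ false ∷ [])

isEven : ℕ → Bool
isEven zero    = true
isEven (suc k) = not (isEven k)

module Constructions (n : ℕ) (adj : Fin n → Fin n → Bool) where

  edgeList : {X : Set} → ((u v : Fin n) → T (adj u v) → X) → List X
  edgeList {X} mk = concatMap (λ u → concatMap (λ v → pick u v (T? (adj u v))) (allFin n)) (allFin n)
    where
    pick : (u v : Fin n) → Dec (T (adj u v)) → List X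
    pick u v (yes p) = [ mk u v p ]
    pick u v (no _)  = []

  -- 2-subdivision G₂ : edge uv becomes path u , w(u,v) , w(v,u) , v

  data SubdV : Set where
    orig : Fin n → SubdV
    mid  : (u v : Fin n) → T (adj u v) → SubdV

  subdAdj : SubdV → SubdV → Bool
  subdAdj (orig x)    (orig y)      = false
  subdAdj (orig x)    (mid u v _)   = x == u
  subdAdj (mid u v _) (orig x)      = x == u
  subdAdj (mid u v _) (mid u' v' _) = (u == v') ∧ (v == u')

  G₂ : Graph
  G₂ = record { V = SubdV
              ; verts = map orig (allFin n) ++ edgeList mid
              ; adj = subdAdj }

  -- s ⊆ N(u), i.e. s is a subset of A(u) (a(u,v) identified with v),
  -- and |s| is even
  okM : Fin n → Subset n → Bool
  okM u s = allᵇ (λ v → not (lookup s v) ∨ adj u v) (allFin n) ∧ isEven ∣ s ∣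

  data YV : Set where
    a : (u v : Fin n) → T (adj u v) → YV
    b : (u v : Fin n) → T (adj u v) → YV
    m : (u : Fin n) (s : Subset n) → T (okM u s) → YV
        -- the element {a(u,v) : v ∈ s} of M(u)

  mList : List YV
  mList = concatMap (λ u → concatMap (λ s → pick u s (T? (okM u s))) (allVecsBool n)) (allFin n)
    where
    pick : (u : Fin n) (s : Subset n) → Dec (T (okM u s)) → List YV
    pick u s (yes p) = [ m u s p ]
    pick u s (no _)  = []

  -- `tw u v = true` marks the (unordered) edge whose connections are twisted
  yAdj : (Fin n → Fin n → Bool) → YV → YV → Bool
  yAdj tw (a u v _)   (m u' s _)    = (u == u') ∧ lookup s v
  yAdj tw (m u' s _)  (a u v _)     = (u == u') ∧ lookup s v
  yAdj tw (b u v _)   (m u' s _)    = (u == u') ∧ not (lookup s v)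
  yAdj tw (m u' s _)  (b u v _)     = (u == u') ∧ not (lookup s v)
  yAdj tw (a u v _)   (a u' v' _)   = (u == v') ∧ (v == u') ∧ not (tw u v)
  yAdj tw (b u v _)   (b u' v' _)   = (u == v') ∧ (v == u') ∧ not (tw u v)
  yAdj tw (a u v _)   (b u' v' _)   = (u == v') ∧ (v == u') ∧ tw u v
  yAdj tw (b u v _)   (a u' v' _)   = (u == v') ∧ (v == u') ∧ tw u v
  yAdj tw (m _ _ _)   (m _ _ _)     = false

  yVerts : List YV
  yVerts = edgeList a ++ edgeList b ++ mList

  Y : Graph
  Y = record { V = YV ; verts = yVerts ; adj = yAdj (λ _ _ → false) }

  Ỹ : Fin n → Fin n → Graph
  Ỹ u₀ v₀ = record { V = YV ; verts = yVerts
                   ; adj = yAdj (λ u v → ((u == u₀) ∧ (v == v₀)) ∨ ((u == v₀) ∧ (v == u₀))) }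

-- Every vertex of Y(G) has a site (an edge end (u,v), carrying a(u,v) and b(u,v), or the middle
-- of u, carrying M(u)) and a label in an 𝔽₂-vector space: a bit for a(u,v)/b(u,v), an even subset
-- of N(u) for a middle vertex. Two vertices at linked sites are adjacent exactly
-- when an affine-linear "defect" of their labels vanishes, the twisted edge contributing the constant.
-- Hence the sum of two homomorphisms G₂ → Ỹ(G) with the same sites is a homomorphism G₂ → Y(G),
-- and adding to each twisted homomorphism a fixed twisted one with the same sites is an injection
-- hom(G₂, Ỹ(G)) → hom(G₂, Y(G)). It misses the homomorphism u ↦ ∅ ∈ M(u), w_{u,v} ↦ b(u,v):
-- a twisted one with these sites would give even sets S_u ⊆ N(u) with
-- [v ∈ S_u] + [u ∈ S_v] = [uv = u₀v₀] over 𝔽₂, and summing over all pairs gives 0 = 1.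

module Submission where

open import Defs
open import Data.Bool using (Bool; false; T)
open import Data.Nat using (ℕ; _≤_; _>_)
open import Data.Fin using (Fin)
open import Relation.Binary.PropositionalEquality using (_≡_)

open import Algebra.Bundles using (CommutativeRing)
open import Data.Bool using (true; not; _∧_; _∨_; _xor_)
open import Data.Bool.Properties
  using ( T-∧; T-∨; T-not-≡; T-irrelevant; not-involutive; ∧-comm; ∧-assoc; ∧-distribˡ-xor; ∧-distribʳ-xor
        ; xor-assoc; xor-same; xor-identityʳ; xor-∧-commutativeRing )
open import Algebra.Properties.Semiring.Sum (CommutativeRing.semiring xor-∧-commutativeRing)
  using (sum-syntax; sum-cong-≗; sum-replicate-zero; ∑-distrib-+; ∑-comm; *-distribˡ-sum)
open import Algebra.Properties.CommutativeSemigroup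
  (CommutativeRing.+-commutativeSemigroup xor-∧-commutativeRing) using (interchange)
open import Data.Empty using (⊥; ⊥-elim)
open import Data.Fin using (zero; suc; _≟_)
import Data.Fin.Properties as Fin
open import Data.Fin.Subset using (Subset; ∣_∣) renaming (⊥ to ∅)
open import Data.List using (List; []; _∷_; _++_; map; concatMap; filter; filterᵇ; length; allFin)
import Data.List as List
open import Data.List.Properties
  using (∷-injective; ∷-injectiveˡ; ∷-injectiveʳ; length-++-sucʳ; concatMap-cong; ≡-dec)
open import Data.List.Membership.Propositional using (_∈_)
open import Data.List.Membership.Propositional.Properties
  using (∈-allFin; ∈-map⁺; ∈-map⁻; ∈-++⁺ˡ; ∈-++⁺ʳ; ∈-++⁻; ∈-∃++; ∈-concatMap⁺; ∈-concatMap⁻; ∈-filter⁺; ∈-filter⁻)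
open import Data.List.Relation.Binary.Pointwise using (Pointwise; []; _∷_)
open import Data.List.Relation.Unary.All as All using (All)
import Data.List.Relation.Unary.All.Properties as All
open import Data.List.Relation.Unary.AllPairs as AllPairs using (_∷_)
import Data.List.Relation.Unary.AllPairs.Properties as AllPairs
open import Data.List.Relation.Unary.Any as Any using (here; there)
open import Data.List.Relation.Unary.Unique.Propositional using (Unique)
import Data.List.Relation.Unary.Unique.Propositional.Properties as Unique
open import Data.Nat using (zero; suc; _<_; s≤s; z≤n)
open import Data.Product using (∃; ∃₂; _×_; _,_; proj₁; proj₂)
import Data.Product.Properties as Product
open import Data.Sum using (_⊎_; inj₁; inj₂)
import Data.Sum.Properties as Sum
open import Data.Unit using (tt)
open import Data.Vec using (Vec; lookup; zipWith) renaming ([] to []ᵥ; _∷_ to _∷ᵥ_)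
import Data.Vec.Properties as Vec
open import Function using (_∘_; Equivalence)
open import Relation.Binary.Definitions using (DecidableEquality)
open import Relation.Binary.PropositionalEquality
  using (_≢_; refl; sym; trans; cong; cong₂; subst; subst₂; module ≡-Reasoning)
open import Relation.Nullary using (Dec; yes; no; ¬_)
open import Relation.Nullary.Decidable using (T?; _×-dec_; dec-true; dec-false; toWitness; isYes≗does; ⌊⌋-map′)

private
  variable
    A B X : Set

-- Booleans and lists

T-implication⁻ : ∀ {a b} → T (not a ∨ b) → T a → T b
T-implication⁻ {true} t _ = t

T-implication⁺ : ∀ {a b} → (T a → T b) → T (not a ∨ b)
T-implication⁺ {true}  f = f tt
T-implication⁺ {false} f = tt

∨-disjoint : ∀ {a b} → (T a → T b → ⊥) → a ∨ b ≡ a xor b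
∨-disjoint {true}  {true}  ¬ab = ⊥-elim (¬ab tt tt)
∨-disjoint {true}  {false} _   = refl
∨-disjoint {false}         _   = refl

¬T⇒≡false : ∀ {b} → ¬ T b → b ≡ false
¬T⇒≡false {true}  ¬t = ⊥-elim (¬t tt)
¬T⇒≡false {false} _  = refl

xor≡false⇒≡ : ∀ {a b} → a xor b ≡ false → a ≡ b
xor≡false⇒≡ {true}  {true}  _ = refl
xor≡false⇒≡ {false} {false} _ = refl

xor-cancelʳ : ∀ x y → (x xor y) xor y ≡ x
xor-cancelʳ x y = trans (xor-assoc x y y) (trans (cong (x xor_) (xor-same y)) (xor-identityʳ x))

allᵇ⁻ : ∀ (p : A → Bool) {xs x} → T (allᵇ p xs) → x ∈ xs → T (p x)
allᵇ⁻ p {_ ∷ _} t (here refl) = proj₁ (Equivalence.to T-∧ t)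
allᵇ⁻ p {_ ∷ _} t (there x∈) = allᵇ⁻ p (proj₂ (Equivalence.to T-∧ t)) x∈

allᵇ⁺ : ∀ (p : A → Bool) xs → (∀ {x} → x ∈ xs → T (p x)) → T (allᵇ p xs)
allᵇ⁺ p []       h = tt
allᵇ⁺ p (_ ∷ xs) h = Equivalence.from T-∧ (h (here refl) , allᵇ⁺ p xs (h ∘ there))

module _ (F : A → A → Bool) (H : B → B → Bool) where

  isHom⁻ : ∀ {g x fx y fy} → T (isHom F H g) →
           (x , fx) ∈ g → (y , fy) ∈ g → T (F x y) → T (H fx fy)
  isHom⁻ t x∈ y∈ = T-implication⁻ (allᵇ⁻ _ (allᵇ⁻ _ t x∈) y∈)

  isHom⁺ : ∀ g → (∀ {x fx y fy} → (x , fx) ∈ g → (y , fy) ∈ g → T (F x y) → T (H fx fy)) →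
           T (isHom F H g)
  isHom⁺ g h = allᵇ⁺ _ g (λ x∈ → allᵇ⁺ _ g (λ y∈ → T-implication⁺ (h x∈ y∈)))

concatMap-unique : ∀ (f : A → List B) {xs} → Unique xs → (∀ x → Unique (f x)) →
                   (∀ {x x′ y} → x ≢ x′ → y ∈ f x → y ∈ f x′ → ⊥) → Unique (concatMap f xs)
concatMap-unique f u uf disjoint =
  Unique.concat⁺ (All.map⁺ (All.tabulate λ {x} _ → uf x))
                 (AllPairs.map⁺ (AllPairs.map (λ x≢x′ {y} (y∈ , y∈′) → disjoint x≢x′ y∈ y∈′) u))

module _ {A B : Set} where

  ∈-maps⁻ : ∀ xs (ys : List B) {g} → g ∈ maps {A} xs ys → map proj₁ g ≡ xs
  ∈-maps⁻ []       ys (here refl) = refl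
  ∈-maps⁻ (x ∷ xs) ys g∈
    with y , g∈′ ← Any.satisfied (∈-concatMap⁻ (λ y → map ((x , y) ∷_) (maps xs ys)) {xs = ys} g∈)
    with g , g∈″ , refl ← ∈-map⁻ ((x , y) ∷_) g∈′
    = cong (x ∷_) (∈-maps⁻ xs ys g∈″)

  ∈-maps⁺ : ∀ xs {ys : List B} {g} → (∀ y → y ∈ ys) → map proj₁ g ≡ xs → g ∈ maps {A} xs ys
  ∈-maps⁺ []       {g = []}          _   refl = here refl
  ∈-maps⁺ (x ∷ xs) {g = (_ , y) ∷ g} all eq with refl , eq′ ← ∷-injective eq =
    ∈-concatMap⁺ (λ y → map ((x , y) ∷_) (maps xs _))
      (Any.map (λ { refl → ∈-map⁺ ((x , y) ∷_) (∈-maps⁺ xs all eq′) }) (all y))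

  maps-unique : ∀ xs {ys : List B} → Unique ys → Unique (maps {A} xs ys)
  maps-unique []       u = All.[] ∷ AllPairs.[]
  maps-unique (x ∷ xs) u =
    concatMap-unique _ u (λ y → Unique.map⁺ ∷-injectiveʳ (maps-unique xs u)) disjoint
    where
    disjoint : ∀ {y y′ g} → y ≢ y′ → g ∈ map ((x , y) ∷_) (maps xs _) → g ∈ map ((x , y′) ∷_) (maps xs _) → ⊥
    disjoint y≢y′ g∈ g∈′
      with _ , _ , refl ← ∈-map⁻ _ g∈
      with _ , _ , eq ← ∈-map⁻ _ g∈′
      = y≢y′ (cong proj₂ (proj₁ (∷-injective eq)))

graphOf : (A → B) → List A → List (A × B)
graphOf f = map (λ x → x , f x)

graphOf-domain : ∀ (f : A → B) xs → map proj₁ (graphOf f xs) ≡ xs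
graphOf-domain f []       = refl
graphOf-domain f (x ∷ xs) = cong (x ∷_) (graphOf-domain f xs)

∈-graphOf⁻ : ∀ {f : A → B} {xs x y} → (x , y) ∈ graphOf f xs → y ≡ f x
∈-graphOf⁻ xy∈ with _ , _ , refl ← ∈-map⁻ _ xy∈ = refl

image-∈ : ∀ {g : List (A × B)} {xs x} → map proj₁ g ≡ xs → x ∈ xs → ∃ λ y → (x , y) ∈ g
image-∈ refl x∈ with (_ , y) , xy∈ , refl ← ∈-map⁻ proj₁ x∈ = y , xy∈

agrees-with-graphOf : ∀ {C : Set} (σ : B → C) {f : A → B} {g x y} →
  map (σ ∘ proj₂) g ≡ map (σ ∘ proj₂) (graphOf f (map proj₁ g)) → (x , y) ∈ g → σ y ≡ σ (f x)
agrees-with-graphOf σ {g = _ ∷ _} eq (here refl) = ∷-injectiveˡ eq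
agrees-with-graphOf σ {g = _ ∷ _} eq (there xy∈) = agrees-with-graphOf σ (∷-injectiveʳ eq) xy∈

headOr : A → List A → A
headOr d []      = d
headOr _ (x ∷ _) = x

headOr-∈ : ∀ {d x : A} {xs} → x ∈ xs → headOr d xs ∈ xs
headOr-∈ {xs = _ ∷ _} _ = here refl

∈-++-remove : ∀ (ys : List A) {zs x y} → y ∈ ys ++ x ∷ zs → y ≢ x → y ∈ ys ++ zs
∈-++-remove ys y∈ y≢x with ∈-++⁻ ys y∈
... | inj₁ y∈ys         = ∈-++⁺ˡ y∈ys
... | inj₂ (here y≡x)   = ⊥-elim (y≢x y≡x)
... | inj₂ (there y∈zs) = ∈-++⁺ʳ ys y∈zs

injection-length-< : ∀ {xs : List A} {ys : List B} {z} (f : A → B) → Unique xs →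
  (∀ {x x′} → x ∈ xs → x′ ∈ xs → f x ≡ f x′ → x ≡ x′) → (∀ {x} → x ∈ xs → f x ∈ ys) →
  z ∈ ys → (∀ {x} → x ∈ xs → f x ≢ z) → length xs < length ys
injection-length-< {xs = []} f _ _ _ (here _)  _ = s≤s z≤n
injection-length-< {xs = []} f _ _ _ (there _) _ = s≤s z≤n
injection-length-< {xs = x ∷ xs} f (x∉ ∷ u) inj into z∈ miss
  with ys₁ , ys₂ , refl ← ∈-∃++ (into (here refl)) =
  subst (suc (length xs) <_) (sym (length-++-sucʳ ys₁ (f x) ys₂))
    (s≤s (injection-length-< f u (λ p q → inj (there p) (there q)) into′
                              (∈-++-remove ys₁ z∈ (miss (here refl) ∘ sym)) (miss ∘ there)))
  where
  into′ : ∀ {x′} → x′ ∈ xs → f x′ ∈ ys₁ ++ ys₂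
  into′ x′∈ = ∈-++-remove ys₁ (into (there x′∈))
                (λ e → All.lookup x∉ x′∈ (inj (here refl) (there x′∈) (sym e)))

count-<-by-injection : ∀ {L : List A} {P Q : A → Bool} (f : A → A) → Unique L →
  (∀ {x} → x ∈ L → T (Q x) → f x ∈ L × T (P (f x))) →
  (∀ {x x′} → x ∈ L → T (Q x) → x′ ∈ L → T (Q x′) → f x ≡ f x′ → x ≡ x′) →
  ∀ {z} → z ∈ L → T (P z) → (∀ {x} → x ∈ L → T (Q x) → f x ≢ z) →
  length (filterᵇ Q L) < length (filterᵇ P L)
count-<-by-injection {P = P} {Q} f u into inj z∈ Pz miss =
  injection-length-< f (Unique.filter⁺ (T? ∘ Q) u)
    (λ p q → let p₁ , p₂ = ∈-filter⁻ (T? ∘ Q) p; q₁ , q₂ = ∈-filter⁻ (T? ∘ Q) q in inj p₁ p₂ q₁ q₂)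
    (λ p → let p₁ , p₂ = ∈-filter⁻ (T? ∘ Q) p; fx∈ , Pfx = into p₁ p₂ in ∈-filter⁺ (T? ∘ P) fx∈ Pfx)
    (∈-filter⁺ (T? ∘ P) z∈ Pz)
    (λ p → let p₁ , p₂ = ∈-filter⁻ (T? ∘ Q) p in miss p₁ p₂)

whenT : ∀ {b} → Dec (T b) → (T b → X) → List X
whenT (yes t) f = f t ∷ []
whenT (no _)  f = []

∈-whenT⁺ : ∀ {b} (d : Dec (T b)) (f : T b → X) t → f t ∈ whenT d f
∈-whenT⁺ (yes t′) f t = here (cong f (T-irrelevant t t′))
∈-whenT⁺ (no ¬t)  f t = ⊥-elim (¬t t)

∈-whenT⁻ : ∀ {b} (d : Dec (T b)) (f : T b → X) {y} → y ∈ whenT d f → ∃ λ t → y ≡ f t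
∈-whenT⁻ (yes t) f (here refl) = t , refl

whenT-unique : ∀ {b} (d : Dec (T b)) (f : T b → X) → Unique (whenT d f)
whenT-unique (yes _) f = All.[] ∷ AllPairs.[]
whenT-unique (no _)  f = AllPairs.[]

module _ {I J : Set} (is : List I) (js : List J) where

  enumerate : (Q : I → J → Bool) → (∀ i j → T (Q i j) → X) → List X
  enumerate Q mk = concatMap (λ i → concatMap (λ j → whenT (T? (Q i j)) (mk i j)) js) is

  module _ {Q : I → J → Bool} (mk : ∀ i j → T (Q i j) → X) where

    ∈-enumerate⁺ : ∀ {i j} → i ∈ is → j ∈ js → ∀ t → mk i j t ∈ enumerate Q mk
    ∈-enumerate⁺ {i} {j} i∈ j∈ t =
      ∈-concatMap⁺ _ (Any.map (λ { refl →
        ∈-concatMap⁺ _ (Any.map (λ { refl → ∈-whenT⁺ (T? (Q i j)) (mk i j) t }) j∈) }) i∈)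

    ∈-row⁻ : ∀ {i y} → y ∈ concatMap (λ j → whenT (T? (Q i j)) (mk i j)) js →
             ∃₂ λ j t → y ≡ mk i j t
    ∈-row⁻ {i} y∈ with j , y∈′ ← Any.satisfied (∈-concatMap⁻ _ {xs = js} y∈) =
      j , ∈-whenT⁻ (T? (Q i j)) (mk i j) y∈′

    ∈-enumerate⁻ : ∀ {y} → y ∈ enumerate Q mk → ∃₂ λ i j → ∃ λ t → y ≡ mk i j t
    ∈-enumerate⁻ y∈ with i , y∈′ ← Any.satisfied (∈-concatMap⁻ _ {xs = is} y∈) = i , ∈-row⁻ y∈′

    enumerate-unique : Unique is → Unique js →
      (∀ {i j t i′ j′ t′} → mk i j t ≡ mk i′ j′ t′ → i ≡ i′ × j ≡ j′) → Unique (enumerate Q mk)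
    enumerate-unique uis ujs inj =
      concatMap-unique _ uis
        (λ i → concatMap-unique _ ujs (λ j → whenT-unique (T? (Q i j)) (mk i j)) (disjoint-cells i))
        disjoint-rows
      where
      disjoint-cells : ∀ i {j j′ y} → j ≢ j′ → y ∈ whenT (T? (Q i j)) (mk i j) →
                       y ∈ whenT (T? (Q i j′)) (mk i j′) → ⊥
      disjoint-cells i {j} {j′} j≢j′ y∈ y∈′
        with _ , refl ← ∈-whenT⁻ (T? (Q i j)) (mk i j) y∈
        with _ , eq ← ∈-whenT⁻ (T? (Q i j′)) (mk i j′) y∈′
        = j≢j′ (proj₂ (inj eq))
      disjoint-rows : ∀ {i i′ y} → i ≢ i′ → y ∈ concatMap (λ j → whenT (T? (Q i j)) (mk i j)) js →
                      y ∈ concatMap (λ j → whenT (T? (Q i′ j)) (mk i′ j)) js → ⊥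
      disjoint-rows i≢i′ y∈ y∈′
        with _ , _ , refl ← ∈-row⁻ y∈
        with _ , _ , eq ← ∈-row⁻ y∈′
        = i≢i′ (proj₁ (inj eq))

-- Defs builds its vertex lists with a local, unnameable helper; unifying with a double concatMap
-- recovers the family of inner lists, which can then be compared with `whenT` by case analysis.
cellsOf : ∀ {I J : Set} (is : List I) (js : List J) (l : List X) {F : I → J → List X} →
          l ≡ concatMap (λ i → concatMap (F i) js) is → I → J → List X
cellsOf _ _ _ {F} _ = F

∈-allVecsBool : ∀ {k} (v : Vec Bool k) → v ∈ allVecsBool k
∈-allVecsBool []ᵥ       = here refl
∈-allVecsBool {suc k} (x ∷ᵥ v) =
  ∈-concatMap⁺ (λ b → map (b ∷ᵥ_) (allVecsBool k))
    (Any.map (λ { refl → ∈-map⁺ (x ∷ᵥ_) (∈-allVecsBool v) }) (bool∈ x))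
  where
  bool∈ : ∀ b → b ∈ true ∷ false ∷ []
  bool∈ true  = here refl
  bool∈ false = there (here refl)

allVecsBool-unique : ∀ k → Unique (allVecsBool k)
allVecsBool-unique zero    = All.[] ∷ AllPairs.[]
allVecsBool-unique (suc k) =
  concatMap-unique _ (((λ ()) All.∷ All.[]) ∷ All.[] ∷ AllPairs.[])
    (λ b → Unique.map⁺ Vec.∷-injectiveʳ (allVecsBool-unique k)) disjoint
  where
  disjoint : ∀ {b b′ v} → b ≢ b′ → v ∈ map (b ∷ᵥ_) (allVecsBool k) → v ∈ map (b′ ∷ᵥ_) (allVecsBool k) → ⊥
  disjoint b≢b′ v∈ v∈′
    with _ , _ , refl ← ∈-map⁻ _ v∈
    with _ , _ , eq ← ∈-map⁻ _ v∈′
    = b≢b′ (Vec.∷-injectiveˡ eq)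

-- Parity over 𝔽₂

==-refl : ∀ {k} (x : Fin k) → (x == x) ≡ true
==-refl x = trans (isYes≗does (x ≟ x)) (dec-true (x ≟ x) refl)

==-≢ : ∀ {k} {x y : Fin k} → x ≢ y → (x == y) ≡ false
==-≢ {x = x} {y} x≢y = trans (isYes≗does (x ≟ y)) (dec-false (x ≟ y) x≢y)

==-sound : ∀ {k} {x y : Fin k} → T (x == y) → x ≡ y
==-sound {x = x} {y} = toWitness {a? = x ≟ y}

==-sym-T : ∀ {k} {x y : Fin k} → T (x == y) → T (y == x)
==-sym-T {x = x} t with refl ← ==-sound {x = x} t = t

==-refl-T : ∀ {k} (x : Fin k) → T (x == x)
==-refl-T x = subst T (sym (==-refl x)) tt

==-sound-∧ : ∀ {k} {x p y q : Fin k} → T ((x == p) ∧ (y == q)) → x ≡ p × y ≡ q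
==-sound-∧ {x = x} {y = y} t = let t₁ , t₂ = Equivalence.to T-∧ t in ==-sound {x = x} t₁ , ==-sound {x = y} t₂

twistAt : ∀ {k} → Fin k → Fin k → Fin k → Fin k → Bool
twistAt p q x y = ((x == p) ∧ (y == q)) ∨ ((x == q) ∧ (y == p))

_⊻_ : ∀ {k} → Subset k → Subset k → Subset k
_⊻_ = zipWith _xor_

⊻-cancelʳ : ∀ {k} (s t : Subset k) → (s ⊻ t) ⊻ t ≡ s
⊻-cancelʳ []ᵥ       []ᵥ       = refl
⊻-cancelʳ (x ∷ᵥ s) (y ∷ᵥ t) = cong₂ _∷ᵥ_ (xor-cancelʳ x y) (⊻-cancelʳ s t)

parity : ∀ {k} → Subset k → Bool
parity {k} s = ∑[ i < k ] lookup s i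

isEven-∣∣ : ∀ {k} (s : Subset k) → isEven ∣ s ∣ ≡ not (parity s)
isEven-∣∣ []ᵥ          = refl
isEven-∣∣ (true ∷ᵥ s)  = cong not (isEven-∣∣ s)
isEven-∣∣ (false ∷ᵥ s) = isEven-∣∣ s

parity-⊻ : ∀ {k} (s t : Subset k) → parity (s ⊻ t) ≡ parity s xor parity t
parity-⊻ s t = trans (sum-cong-≗ (λ i → Vec.lookup-zipWith _xor_ i s t)) (∑-distrib-+ (lookup s) (lookup t))

parity-∅ : ∀ k → parity (∅ {n = k}) ≡ false
parity-∅ k = trans (sum-cong-≗ {k} (λ i → Vec.lookup-replicate i false)) (sum-replicate-zero k)

∑-select : ∀ {k} (p : Fin k) (f : Fin k → Bool) → ∑[ x < k ] ((x == p) ∧ f x) ≡ f p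
∑-select {suc k} zero    f = trans (cong (f zero xor_) (sum-replicate-zero k)) (xor-identityʳ (f zero))
∑-select {suc k} (suc p) f =
  trans (sum-cong-≗ {k} (λ x → cong (_∧ f (suc x)) (⌊⌋-map′ (cong suc) Fin.suc-injective (x ≟ p))))
        (∑-select p (f ∘ suc))

module _ {k : ℕ} where

  ∑∑-cong : {f g : Fin k → Fin k → Bool} → (∀ x y → f x y ≡ g x y) →
            ∑[ x < k ] ∑[ y < k ] f x y ≡ ∑[ x < k ] ∑[ y < k ] g x y
  ∑∑-cong eq = sum-cong-≗ (λ x → sum-cong-≗ (eq x))

  ∑∑-distrib-xor : (f g : Fin k → Fin k → Bool) →
    ∑[ x < k ] ∑[ y < k ] (f x y xor g x y) ≡ (∑[ x < k ] ∑[ y < k ] f x y) xor (∑[ x < k ] ∑[ y < k ] g x y)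
  ∑∑-distrib-xor f g =
    trans (sum-cong-≗ (λ x → ∑-distrib-+ (f x) (g x))) (∑-distrib-+ (λ x → ∑[ y < k ] f x y) (λ x → ∑[ y < k ] g x y))

  ∑∑-select : (p q : Fin k) (g : Fin k → Fin k → Bool) →
              ∑[ x < k ] ∑[ y < k ] (g x y ∧ ((x == p) ∧ (y == q))) ≡ g p q
  ∑∑-select p q g = begin
    ∑[ x < k ] ∑[ y < k ] (g x y ∧ ((x == p) ∧ (y == q)))
      ≡⟨ ∑∑-cong (λ x y → trans (∧-comm (g x y) _) (∧-assoc (x == p) (y == q) (g x y))) ⟩
    ∑[ x < k ] ∑[ y < k ] ((x == p) ∧ ((y == q) ∧ g x y))
      ≡⟨ sum-cong-≗ (λ x → *-distribˡ-sum (x == p) (λ y → (y == q) ∧ g x y)) ⟨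
    ∑[ x < k ] ((x == p) ∧ ∑[ y < k ] ((y == q) ∧ g x y))
      ≡⟨ ∑-select p _ ⟩
    ∑[ y < k ] ((y == q) ∧ g p y)
      ≡⟨ ∑-select q (g p) ⟩
    g p q ∎
    where open ≡-Reasoning

infix 4 _≺_
_≺_ : ∀ {k} → Fin k → Fin k → Bool
zero  ≺ zero  = false
zero  ≺ suc _ = true
suc _ ≺ zero  = false
suc x ≺ suc y = x ≺ y

≺-xor : ∀ {k} (x y : Fin k) → (x ≺ y) xor (y ≺ x) ≡ not (x == y)
≺-xor zero    zero    = refl
≺-xor zero    (suc y) = refl
≺-xor (suc x) zero    = refl
≺-xor (suc x) (suc y) = trans (≺-xor x y) (cong not (sym (⌊⌋-map′ (cong suc) Fin.suc-injective (x ≟ y))))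

module _ {k : ℕ} (M : Fin k → Fin k → Bool) where

  -- Off the diagonal exactly one of x ≺ y, y ≺ x holds, so every entry is counted by one ordered pair.
  ∑∑-by-pairs : (∀ x → M x x ≡ false) →
    ∑[ x < k ] ∑[ y < k ] M x y ≡ ∑[ x < k ] ∑[ y < k ] ((x ≺ y) ∧ (M x y xor M y x))
  ∑∑-by-pairs diagonal = begin
    ∑[ x < k ] ∑[ y < k ] M x y
      ≡⟨ ∑∑-cong split ⟩
    ∑[ x < k ] ∑[ y < k ] ((x ≺ y) ∧ M x y xor (y ≺ x) ∧ M x y)
      ≡⟨ ∑∑-distrib-xor (λ x y → (x ≺ y) ∧ M x y) (λ x y → (y ≺ x) ∧ M x y) ⟩
    (∑[ x < k ] ∑[ y < k ] ((x ≺ y) ∧ M x y)) xor (∑[ x < k ] ∑[ y < k ] ((y ≺ x) ∧ M x y))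
      ≡⟨ cong ((∑[ x < k ] ∑[ y < k ] ((x ≺ y) ∧ M x y)) xor_) (∑-comm (λ x y → (y ≺ x) ∧ M x y)) ⟩
    (∑[ x < k ] ∑[ y < k ] ((x ≺ y) ∧ M x y)) xor (∑[ x < k ] ∑[ y < k ] ((x ≺ y) ∧ M y x))
      ≡⟨ ∑∑-distrib-xor (λ x y → (x ≺ y) ∧ M x y) (λ x y → (x ≺ y) ∧ M y x) ⟨
    ∑[ x < k ] ∑[ y < k ] ((x ≺ y) ∧ M x y xor (x ≺ y) ∧ M y x)
      ≡⟨ ∑∑-cong (λ x y → ∧-distribˡ-xor (x ≺ y) (M x y) (M y x)) ⟨
    ∑[ x < k ] ∑[ y < k ] ((x ≺ y) ∧ (M x y xor M y x)) ∎
    where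
    open ≡-Reasoning
    off-diagonal : ∀ x y → M x y ≡ not (x == y) ∧ M x y
    off-diagonal x y with x ≟ y
    ... | yes refl = diagonal x
    ... | no _     = refl
    split : ∀ x y → M x y ≡ (x ≺ y) ∧ M x y xor (y ≺ x) ∧ M x y
    split x y = trans (off-diagonal x y)
                      (trans (cong (_∧ M x y) (sym (≺-xor x y))) (∧-distribʳ-xor (M x y) (x ≺ y) (y ≺ x)))

  ∑∑-twisted-skew≡true : ∀ {p q} → (∀ x → M x x ≡ false) → p ≢ q →
    (∀ x y → M x y xor M y x ≡ twistAt p q x y) → ∑[ x < k ] ∑[ y < k ] M x y ≡ true
  ∑∑-twisted-skew≡true {p} {q} diagonal p≢q skew = begin
    ∑[ x < k ] ∑[ y < k ] M x y
      ≡⟨ ∑∑-by-pairs diagonal ⟩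
    ∑[ x < k ] ∑[ y < k ] ((x ≺ y) ∧ (M x y xor M y x))
      ≡⟨ ∑∑-cong (λ x y → cong ((x ≺ y) ∧_) (trans (skew x y) (∨-disjoint (both x y)))) ⟩
    ∑[ x < k ] ∑[ y < k ] ((x ≺ y) ∧ ((x == p) ∧ (y == q) xor (x == q) ∧ (y == p)))
      ≡⟨ ∑∑-cong (λ x y → ∧-distribˡ-xor (x ≺ y) ((x == p) ∧ (y == q)) ((x == q) ∧ (y == p))) ⟩
    ∑[ x < k ] ∑[ y < k ] ((x ≺ y) ∧ ((x == p) ∧ (y == q)) xor (x ≺ y) ∧ ((x == q) ∧ (y == p)))
      ≡⟨ ∑∑-distrib-xor (λ x y → (x ≺ y) ∧ ((x == p) ∧ (y == q))) (λ x y → (x ≺ y) ∧ ((x == q) ∧ (y == p))) ⟩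
    (∑[ x < k ] ∑[ y < k ] ((x ≺ y) ∧ ((x == p) ∧ (y == q)))) xor
    (∑[ x < k ] ∑[ y < k ] ((x ≺ y) ∧ ((x == q) ∧ (y == p))))
      ≡⟨ cong₂ _xor_ (∑∑-select p q _≺_) (∑∑-select q p _≺_) ⟩
    (p ≺ q) xor (q ≺ p)
      ≡⟨ ≺-xor p q ⟩
    not (p == q)
      ≡⟨ cong not (==-≢ p≢q) ⟩
    true ∎
    where
    open ≡-Reasoning
    both : ∀ x y → T ((x == p) ∧ (y == q)) → T ((x == q) ∧ (y == p)) → ⊥
    both x y t t′ = p≢q (trans (sym (proj₁ (==-sound-∧ {x = x} {p} {y} {q} t)))
                               (proj₁ (==-sound-∧ {x = x} {q} {y} {p} t′)))

-- The graphs Y(G) and Ỹ(G)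

module Gadgets (n : ℕ) (adj : Fin n → Fin n → Bool) where
  open Constructions n adj

  untwisted : Fin n → Fin n → Bool
  untwisted _ _ = false

  Site : Set
  Site = (Fin n × Fin n) ⊎ Fin n

  pattern end u v  = inj₁ (u , v)
  pattern centre u = inj₂ u

  _≟ˢ_ : DecidableEquality Site
  _≟ˢ_ = Sum.≡-dec (Product.≡-dec _≟_ _≟_) _≟_

  site : YV → Site
  site (a u v _) = end u v
  site (b u v _) = end u v
  site (m u _ _) = centre u

  Label : Set
  Label = Bool × Subset n

  isA : YV → Bool
  isA (a _ _ _) = true
  isA _         = false

  subsetOf : YV → Subset n
  subsetOf (m _ s _) = s
  subsetOf _         = ∅

  -- An edge end is labelled by its bit, a middle vertex by its subset; the other component is a dummy.
  label : YV → Label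
  label p = isA p , subsetOf p

  _⊕ˡ_ : Label → Label → Label
  (x , s) ⊕ˡ (y , t) = x xor y , s ⊻ t

  vertex-≡ : ∀ {p q} → site p ≡ site q → label p ≡ label q → p ≡ q
  vertex-≡ {a u v e} {a _ _ e′} refl refl = cong (a u v) (T-irrelevant e e′)
  vertex-≡ {b u v e} {b _ _ e′} refl refl = cong (b u v) (T-irrelevant e e′)
  vertex-≡ {m u s ok} {m _ _ ok′} refl refl = cong (m u s) (T-irrelevant ok ok′)
  vertex-≡ {a _ _ _} {b _ _ _} refl ()
  vertex-≡ {b _ _ _} {a _ _ _} refl ()

  okM-support : ∀ {u s v} → T (okM u s) → T (lookup s v) → T (adj u v)
  okM-support {u} {s} {v} ok =
    T-implication⁻ (allᵇ⁻ (λ w → not (lookup s w) ∨ adj u w) (proj₁ (Equivalence.to T-∧ ok)) (∈-allFin v))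

  okM-parity : ∀ {u s} → T (okM u s) → parity s ≡ false
  okM-parity {u} {s} ok = Equivalence.to T-not-≡ (subst T (isEven-∣∣ s) (proj₂ (Equivalence.to T-∧ ok)))

  okM-outside : ∀ {u s v} → T (okM u s) → ¬ T (adj u v) → lookup s v ≡ false
  okM-outside {u} {s} {v} ok ¬uv = ¬T⇒≡false (¬uv ∘ okM-support {u} {s} {v} ok)

  okM-intro : ∀ {u s} → (∀ v → T (lookup s v) → T (adj u v)) → parity s ≡ false → T (okM u s)
  okM-intro {s = s} support even = Equivalence.from T-∧
    ( allᵇ⁺ _ (allFin n) (λ {v} _ → T-implication⁺ (support v))
    , subst T (sym (isEven-∣∣ s)) (Equivalence.from T-not-≡ even) )

  okM-∅ : ∀ u → T (okM u ∅)
  okM-∅ u = okM-intro {u} {∅} (λ v t → ⊥-elim (subst T (Vec.lookup-replicate v false) t)) (parity-∅ n)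

  okM-⊻ : ∀ {u s t} → T (okM u s) → T (okM u t) → T (okM u (s ⊻ t))
  okM-⊻ {u} {s} {t} ok ok′ =
    okM-intro {u} {s ⊻ t} support
      (trans (parity-⊻ s t) (cong₂ _xor_ (okM-parity {u} {s} ok) (okM-parity {u} {t} ok′)))
    where
    support : ∀ v → T (lookup (s ⊻ t) v) → T (adj u v)
    support v st with lookup s v in eq | subst T (Vec.lookup-zipWith _xor_ v s t) st
    ... | true  | _  = okM-support {u} {s} ok (subst T (sym eq) tt)
    ... | false | tv = okM-support {u} {t} ok′ tv

  site-centre : ∀ {u} w → site w ≡ centre u → ∃₂ λ s ok → w ≡ m u s ok
  site-centre (m _ s ok) refl = s , ok , refl

  endpoint : ∀ u v → T (adj u v) → Bool → YV
  endpoint u v e true  = a u v e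
  endpoint u v e false = b u v e

  -- Only meaningful for vertices of equal site, where the last fallback clause is never reached.
  infixl 6 _⊕_
  _⊕_ : YV → YV → YV
  a u v e  ⊕ q = endpoint u v e (not (isA q))
  b u v e  ⊕ q = endpoint u v e (isA q)
  m u s ok ⊕ q with T? (okM u (s ⊻ subsetOf q))
  ... | yes ok′ = m u (s ⊻ subsetOf q) ok′
  ... | no _    = m u s ok

  site-endpoint : ∀ u v e x → site (endpoint u v e x) ≡ end u v
  site-endpoint u v e true  = refl
  site-endpoint u v e false = refl

  site-⊕ : ∀ p q → site (p ⊕ q) ≡ site p
  site-⊕ (a u v e) q = site-endpoint u v e (not (isA q))
  site-⊕ (b u v e) q = site-endpoint u v e (isA q)
  site-⊕ (m u s ok) q with T? (okM u (s ⊻ subsetOf q))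
  ... | yes _ = refl
  ... | no _  = refl

  ∅⊻∅ : ∅ ⊻ ∅ ≡ ∅ {n = n}
  ∅⊻∅ = Vec.zipWith-replicate _xor_ false false

  label-⊕ : ∀ {p q} → site p ≡ site q → label (p ⊕ q) ≡ label p ⊕ˡ label q
  label-⊕ {a _ _ _} {a _ _ _} refl = cong (false ,_) (sym ∅⊻∅)
  label-⊕ {a _ _ _} {b _ _ _} refl = cong (true ,_)  (sym ∅⊻∅)
  label-⊕ {b _ _ _} {a _ _ _} refl = cong (true ,_)  (sym ∅⊻∅)
  label-⊕ {b _ _ _} {b _ _ _} refl = cong (false ,_) (sym ∅⊻∅)
  label-⊕ {m u s ok} {m _ t ok′} refl with T? (okM u (s ⊻ t))
  ... | yes _   = refl
  ... | no ¬ok  = ⊥-elim (¬ok (okM-⊻ {u} {s} {t} ok ok′))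

  ⊕ˡ-cancelʳ : ∀ l l′ → (l ⊕ˡ l′) ⊕ˡ l′ ≡ l
  ⊕ˡ-cancelʳ (x , s) (y , t) = cong₂ _,_ (xor-cancelʳ x y) (⊻-cancelʳ s t)

  ⊕-cancelʳ : ∀ {p q} → site p ≡ site q → (p ⊕ q) ⊕ q ≡ p
  ⊕-cancelʳ {p} {q} sp≡sq = vertex-≡ (trans (site-⊕ (p ⊕ q) q) (site-⊕ p q)) (begin
    label ((p ⊕ q) ⊕ q)           ≡⟨ label-⊕ (trans (site-⊕ p q) sp≡sq) ⟩
    label (p ⊕ q) ⊕ˡ label q      ≡⟨ cong (_⊕ˡ label q) (label-⊕ sp≡sq) ⟩
    (label p ⊕ˡ label q) ⊕ˡ label q ≡⟨ ⊕ˡ-cancelʳ (label p) (label q) ⟩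
    label p                       ∎)
    where open ≡-Reasoning

  linked : Site → Site → Bool
  linked (end u v)   (end u′ v′) = (u == v′) ∧ (v == u′)
  linked (end u _)   (centre u′) = u == u′
  linked (centre u′) (end u _)   = u == u′
  linked (centre _)  (centre _)  = false

  -- Between linked sites, an edge is present exactly when this bit vanishes: an edge end is
  -- joined to a middle vertex iff its bit records membership in that vertex's subset, and the
  -- two ends of an edge uv are joined iff their bits differ exactly when uv is twisted.
  defect : (Fin n → Fin n → Bool) → Site → Site → Label → Label → Bool
  defect tw (end u v)  (end _ _)  (x , _) (y , _) = (x xor y) xor tw u v
  defect tw (end _ v)  (centre _) (x , _) (_ , t) = x xor lookup t v
  defect tw (centre _) (end _ v)  (_ , s) (y , _) = y xor lookup s v
  defect tw (centre _) (centre _) _       _       = false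

  yAdj-decomposition : ∀ tw p q →
    yAdj tw p q ≡ linked (site p) (site q) ∧ not (defect tw (site p) (site q) (label p) (label q))
  yAdj-decomposition tw (a u v _) (a u′ v′ _) = sym (∧-assoc (u == v′) (v == u′) _)
  yAdj-decomposition tw (a u v _) (b u′ v′ _) =
    trans (cong (λ c → (u == v′) ∧ (v == u′) ∧ c) (sym (not-involutive (tw u v)))) (sym (∧-assoc (u == v′) (v == u′) _))
  yAdj-decomposition tw (b u v _) (a u′ v′ _) =
    trans (cong (λ c → (u == v′) ∧ (v == u′) ∧ c) (sym (not-involutive (tw u v)))) (sym (∧-assoc (u == v′) (v == u′) _))
  yAdj-decomposition tw (b u v _) (b u′ v′ _) = sym (∧-assoc (u == v′) (v == u′) _)
  yAdj-decomposition tw (a u v _) (m u′ s _) = cong ((u == u′) ∧_) (sym (not-involutive (lookup s v)))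
  yAdj-decomposition tw (b u v _) (m u′ s _) = refl
  yAdj-decomposition tw (m u′ s _) (a u v _) = cong ((u == u′) ∧_) (sym (not-involutive (lookup s v)))
  yAdj-decomposition tw (m u′ s _) (b u v _) = refl
  yAdj-decomposition tw (m _ _ _) (m _ _ _) = refl

  module _ {tw : Fin n → Fin n → Bool} (p q : YV) where

    adjacent⇒linked : T (yAdj tw p q) → T (linked (site p) (site q))
    adjacent⇒linked t = proj₁ (Equivalence.to T-∧ (subst T (yAdj-decomposition tw p q) t))

    adjacent⇒defect≡false : T (yAdj tw p q) → defect tw (site p) (site q) (label p) (label q) ≡ false
    adjacent⇒defect≡false t =
      Equivalence.to T-not-≡ (proj₂ (Equivalence.to T-∧ (subst T (yAdj-decomposition tw p q) t)))

    adjacent-intro : T (linked (site p) (site q)) → defect tw (site p) (site q) (label p) (label q) ≡ false →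
                     T (yAdj tw p q)
    adjacent-intro l d =
      subst T (sym (yAdj-decomposition tw p q)) (Equivalence.from T-∧ (l , Equivalence.from T-not-≡ d))

  defect-⊕ : ∀ tw σ σ′ l₁ l₂ l₁′ l₂′ →
    defect untwisted σ σ′ (l₁ ⊕ˡ l₂) (l₁′ ⊕ˡ l₂′) ≡ defect tw σ σ′ l₁ l₁′ xor defect tw σ σ′ l₂ l₂′
  defect-⊕ tw (end u v) (end _ _) (x₁ , _) (x₂ , _) (y₁ , _) (y₂ , _) = begin
    ((x₁ xor x₂) xor (y₁ xor y₂)) xor false      ≡⟨ xor-identityʳ _ ⟩
    (x₁ xor x₂) xor (y₁ xor y₂)                  ≡⟨ interchange x₁ x₂ y₁ y₂ ⟩
    (x₁ xor y₁) xor (x₂ xor y₂)                  ≡⟨ xor-identityʳ _ ⟨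
    ((x₁ xor y₁) xor (x₂ xor y₂)) xor false      ≡⟨ cong (((x₁ xor y₁) xor (x₂ xor y₂)) xor_) (xor-same (tw u v)) ⟨
    ((x₁ xor y₁) xor (x₂ xor y₂)) xor (tw u v xor tw u v)
                                                 ≡⟨ interchange (x₁ xor y₁) (x₂ xor y₂) (tw u v) (tw u v) ⟩
    ((x₁ xor y₁) xor tw u v) xor ((x₂ xor y₂) xor tw u v) ∎
    where open ≡-Reasoning
  defect-⊕ tw (end _ v) (centre _) (x₁ , _) (x₂ , _) (_ , t₁) (_ , t₂) =
    trans (cong ((x₁ xor x₂) xor_) (Vec.lookup-zipWith _xor_ v t₁ t₂)) (interchange x₁ x₂ (lookup t₁ v) (lookup t₂ v))
  defect-⊕ tw (centre _) (end _ v) (_ , s₁) (_ , s₂) (y₁ , _) (y₂ , _) =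
    trans (cong ((y₁ xor y₂) xor_) (Vec.lookup-zipWith _xor_ v s₁ s₂)) (interchange y₁ y₂ (lookup s₁ v) (lookup s₂ v))
  defect-⊕ tw (centre _) (centre _) _ _ _ _ = refl

  ⊕-adjacent : ∀ {tw p p′ q q′} → site p ≡ site q → site p′ ≡ site q′ →
               T (yAdj tw p p′) → T (yAdj tw q q′) → T (yAdj untwisted (p ⊕ q) (p′ ⊕ q′))
  ⊕-adjacent {tw} {p} {p′} {q} {q′} sp sp′ pp′ qq′ =
    adjacent-intro (p ⊕ q) (p′ ⊕ q′)
      (subst T (sym (cong₂ linked (site-⊕ p q) (site-⊕ p′ q′))) (adjacent⇒linked p p′ pp′)) (begin
      defect untwisted (site (p ⊕ q)) (site (p′ ⊕ q′)) (label (p ⊕ q)) (label (p′ ⊕ q′))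
        ≡⟨ cong₂ (λ σ σ′ → defect untwisted σ σ′ (label (p ⊕ q)) (label (p′ ⊕ q′))) (site-⊕ p q) (site-⊕ p′ q′) ⟩
      defect untwisted (site p) (site p′) (label (p ⊕ q)) (label (p′ ⊕ q′))
        ≡⟨ cong₂ (defect untwisted (site p) (site p′)) (label-⊕ sp) (label-⊕ sp′) ⟩
      defect untwisted (site p) (site p′) (label p ⊕ˡ label q) (label p′ ⊕ˡ label q′)
        ≡⟨ defect-⊕ tw (site p) (site p′) (label p) (label q) (label p′) (label q′) ⟩
      defect tw (site p) (site p′) (label p) (label p′) xor defect tw (site p) (site p′) (label q) (label q′)
        ≡⟨ cong₂ _xor_ (adjacent⇒defect≡false p p′ pp′)
                       (trans (cong₂ (λ σ σ′ → defect tw σ σ′ (label q) (label q′)) sp sp′)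
                              (adjacent⇒defect≡false q q′ qq′)) ⟩
      false ∎)
    where open ≡-Reasoning

  bit-at-centre : ∀ {tw p q u v} → site p ≡ centre u → site q ≡ end u v → T (yAdj tw p q) →
                  isA q ≡ lookup (subsetOf p) v
  bit-at-centre {tw} {p} {q} sp sq t with site p | site q | sp | sq | adjacent⇒defect≡false {tw} p q t
  ... | _ | _ | refl | refl | d = xor≡false⇒≡ d

  bits-across-edge : ∀ {tw p q u v} → site p ≡ end u v → site q ≡ end v u → T (yAdj tw p q) →
                     isA p xor isA q ≡ tw u v
  bits-across-edge {tw} {p} {q} sp sq t with site p | site q | sp | sq | adjacent⇒defect≡false {tw} p q t
  ... | _ | _ | refl | refl | d = xor≡false⇒≡ d

  edgeList-enumerate : ∀ {X} (mk : (u v : Fin n) → T (adj u v) → X) →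
                       edgeList mk ≡ enumerate (allFin n) (allFin n) adj mk
  edgeList-enumerate mk = concatMap-cong (λ u → concatMap-cong (cell u) (allFin n)) (allFin n)
    where
    cell : ∀ u v → cellsOf (allFin n) (allFin n) (edgeList mk) refl u v ≡ whenT (T? (adj u v)) (mk u v)
    cell u v with T? (adj u v)
    ... | yes _ = refl
    ... | no _  = refl

  mList-enumerate : mList ≡ enumerate (allFin n) (allVecsBool n) okM m
  mList-enumerate = concatMap-cong (λ u → concatMap-cong (cell u) (allVecsBool n)) (allFin n)
    where
    cell : ∀ u s → cellsOf (allFin n) (allVecsBool n) mList refl u s ≡ whenT (T? (okM u s)) (m u s)
    cell u s with T? (okM u s)
    ... | yes _ = refl
    ... | no _  = refl

  aVerts bVerts mVerts : List YV
  aVerts = enumerate (allFin n) (allFin n) adj a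
  bVerts = enumerate (allFin n) (allFin n) adj b
  mVerts = enumerate (allFin n) (allVecsBool n) okM m

  yVerts-enumerate : yVerts ≡ aVerts ++ bVerts ++ mVerts
  yVerts-enumerate = cong₂ _++_ (edgeList-enumerate a) (cong₂ _++_ (edgeList-enumerate b) mList-enumerate)

  ∈-yVerts : ∀ y → y ∈ yVerts
  ∈-yVerts y = subst (y ∈_) (sym yVerts-enumerate) (listed y)
    where
    listed : ∀ y → y ∈ aVerts ++ bVerts ++ mVerts
    listed (a u v e)  = ∈-++⁺ˡ (∈-enumerate⁺ (allFin n) (allFin n) a (∈-allFin u) (∈-allFin v) e)
    listed (b u v e)  = ∈-++⁺ʳ aVerts (∈-++⁺ˡ (∈-enumerate⁺ (allFin n) (allFin n) b (∈-allFin u) (∈-allFin v) e))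
    listed (m u s ok) =
      ∈-++⁺ʳ aVerts (∈-++⁺ʳ bVerts (∈-enumerate⁺ (allFin n) (allVecsBool n) m (∈-allFin u) (∈-allVecsBool s) ok))

  yVerts-unique : Unique yVerts
  yVerts-unique = subst Unique (sym yVerts-enumerate)
    (Unique.++⁺ aVerts-unique (Unique.++⁺ bVerts-unique mVerts-unique b∉m) a∉bm)
    where
    aVerts-unique : Unique aVerts
    aVerts-unique = enumerate-unique (allFin n) (allFin n) a (Unique.allFin⁺ n) (Unique.allFin⁺ n) λ { refl → refl , refl }
    bVerts-unique : Unique bVerts
    bVerts-unique = enumerate-unique (allFin n) (allFin n) b (Unique.allFin⁺ n) (Unique.allFin⁺ n) λ { refl → refl , refl }
    mVerts-unique : Unique mVerts
    mVerts-unique =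
      enumerate-unique (allFin n) (allVecsBool n) m (Unique.allFin⁺ n) (allVecsBool-unique n) λ { refl → refl , refl }
    b∉m : ∀ {y} → ¬ (y ∈ bVerts × y ∈ mVerts)
    b∉m (y∈ , y∈′) with _ , _ , _ , refl ← ∈-enumerate⁻ (allFin n) (allFin n) b y∈
                   with ∈-enumerate⁻ (allFin n) (allVecsBool n) m y∈′
    ... | _ , _ , _ , ()
    a∉bm : ∀ {y} → ¬ (y ∈ aVerts × y ∈ bVerts ++ mVerts)
    a∉bm (y∈ , y∈′) with _ , _ , _ , refl ← ∈-enumerate⁻ (allFin n) (allFin n) a y∈
                    with ∈-++⁻ bVerts y∈′
    ... | inj₁ y∈b with ∈-enumerate⁻ (allFin n) (allFin n) b y∈b
    ...   | _ , _ , _ , ()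
    a∉bm (y∈ , y∈′) | inj₂ y∈m with ∈-enumerate⁻ (allFin n) (allVecsBool n) m y∈m
    ...   | _ , _ , _ , ()

  orig-∈ : ∀ x → orig x ∈ Graph.verts G₂
  orig-∈ x = ∈-++⁺ˡ (∈-map⁺ orig (∈-allFin x))

  mid-∈ : ∀ x y e → mid x y e ∈ Graph.verts G₂
  mid-∈ x y e = ∈-++⁺ʳ (map orig (allFin n)) (subst (mid x y e ∈_) (sym (edgeList-enumerate mid))
    (∈-enumerate⁺ (allFin n) (allFin n) mid (∈-allFin x) (∈-allFin y) e))

  module Untwisting {A : Set} (adjF : A → A → Bool) (xs : List A) (tw : Fin n → Fin n → Bool) where

    Map : Set
    Map = List (A × YV)

    candidates : List Map
    candidates = maps xs yVerts

    twisted plain : Map → Bool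
    twisted = isHom adjF (yAdj tw)
    plain   = isHom adjF (yAdj untwisted)

    sites : Map → List Site
    sites = map (site ∘ proj₂)

    Aligned : Map → Map → Set
    Aligned = Pointwise (λ e e′ → proj₁ e ≡ proj₁ e′ × site (proj₂ e) ≡ site (proj₂ e′))

    aligned : ∀ {g h} → map proj₁ g ≡ map proj₁ h → sites g ≡ sites h → Aligned g h
    aligned {[]}    {[]}    _ _ = []
    aligned {_ ∷ _} {_ ∷ _} d s = (∷-injectiveˡ d , ∷-injectiveˡ s) ∷ aligned (∷-injectiveʳ d) (∷-injectiveʳ s)

    infixl 6 _⊕ᴹ_
    _⊕ᴹ_ : Map → Map → Map
    _⊕ᴹ_ = List.zipWith (λ (x , p) (_ , q) → x , p ⊕ q)

    ⊕ᴹ-domain : ∀ {g h} → Aligned g h → map proj₁ (g ⊕ᴹ h) ≡ map proj₁ g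
    ⊕ᴹ-domain []       = refl
    ⊕ᴹ-domain (_ ∷ al) = cong (_ ∷_) (⊕ᴹ-domain al)

    ⊕ᴹ-sites : ∀ {g h} → Aligned g h → sites (g ⊕ᴹ h) ≡ sites g
    ⊕ᴹ-sites []       = refl
    ⊕ᴹ-sites {(_ , p) ∷ _} {(_ , q) ∷ _} (_ ∷ al) = cong₂ _∷_ (site-⊕ p q) (⊕ᴹ-sites al)

    ⊕ᴹ-cancelʳ : ∀ {g h} → Aligned g h → (g ⊕ᴹ h) ⊕ᴹ h ≡ g
    ⊕ᴹ-cancelʳ []              = refl
    ⊕ᴹ-cancelʳ ((_ , sp) ∷ al) = cong₂ _∷_ (cong (_ ,_) (⊕-cancelʳ sp)) (⊕ᴹ-cancelʳ al)

    ∈-⊕ᴹ⁻ : ∀ {g h e} → Aligned g h → e ∈ g ⊕ᴹ h →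
            ∃₂ λ x p → ∃ λ q → e ≡ (x , p ⊕ q) × (x , p) ∈ g × (x , q) ∈ h × site p ≡ site q
    ∈-⊕ᴹ⁻ {(x , p) ∷ _} {(_ , q) ∷ _} ((refl , sp) ∷ _)  (here refl) = x , p , q , refl , here refl , here refl , sp
    ∈-⊕ᴹ⁻ (_ ∷ al) (there e∈) =
      let x , p , q , eq , p∈ , q∈ , sp = ∈-⊕ᴹ⁻ al e∈ in x , p , q , eq , there p∈ , there q∈ , sp

    ⊕ᴹ-plain : ∀ {g h} → Aligned g h → T (twisted g) → T (twisted h) → T (plain (g ⊕ᴹ h))
    ⊕ᴹ-plain {g} {h} al tg th = isHom⁺ adjF (yAdj untwisted) (g ⊕ᴹ h) preserved
      where
      preserved : ∀ {x fx y fy} → (x , fx) ∈ g ⊕ᴹ h → (y , fy) ∈ g ⊕ᴹ h → T (adjF x y) → T (yAdj untwisted fx fy)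
      preserved e₁ e₂ xy
        with _ , p , q , refl , p∈ , q∈ , sp ← ∈-⊕ᴹ⁻ al e₁
        with _ , p′ , q′ , refl , p′∈ , q′∈ , sp′ ← ∈-⊕ᴹ⁻ al e₂
        = ⊕-adjacent sp sp′ (isHom⁻ adjF (yAdj tw) tg p∈ p′∈ xy) (isHom⁻ adjF (yAdj tw) th q∈ q′∈ xy)

    reference : List Site → Map
    reference σ = headOr [] (filter (λ r → T? (twisted r) ×-dec ≡-dec _≟ˢ_ (sites r) σ) candidates)

    module _ {g} (g∈ : g ∈ candidates) (tg : T (twisted g)) where

      reference-spec : reference (sites g) ∈ candidates × T (twisted (reference (sites g))) ×
                       sites (reference (sites g)) ≡ sites g
      reference-spec =
        let r∈ , tr , sr = ∈-filter⁻ (λ r → T? (twisted r) ×-dec _) (headOr-∈ (∈-filter⁺ _ g∈ (tg , refl)))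
        in r∈ , tr , sr

      reference-aligned : Aligned g (reference (sites g))
      reference-aligned = let r∈ , _ , sr = reference-spec in
        aligned (trans (∈-maps⁻ xs yVerts g∈) (sym (∈-maps⁻ xs yVerts r∈))) (sym sr)

    untwist : Map → Map
    untwist g = g ⊕ᴹ reference (sites g)

    module _ {g} (g∈ : g ∈ candidates) (tg : T (twisted g)) where

      untwist-sites : sites (untwist g) ≡ sites g
      untwist-sites = ⊕ᴹ-sites (reference-aligned g∈ tg)

      untwist-∈ : untwist g ∈ candidates
      untwist-∈ = ∈-maps⁺ xs ∈-yVerts (trans (⊕ᴹ-domain (reference-aligned g∈ tg)) (∈-maps⁻ xs yVerts g∈))

      untwist-plain : T (plain (untwist g))
      untwist-plain = let _ , tr , _ = reference-spec g∈ tg in ⊕ᴹ-plain (reference-aligned g∈ tg) tg tr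

    untwist-injective : ∀ {g g′} → g ∈ candidates → T (twisted g) → g′ ∈ candidates → T (twisted g′) →
                        untwist g ≡ untwist g′ → g ≡ g′
    untwist-injective {g} {g′} g∈ tg g′∈ tg′ eq = begin
      g                                       ≡⟨ ⊕ᴹ-cancelʳ (reference-aligned g∈ tg) ⟨
      untwist g ⊕ᴹ reference (sites g)        ≡⟨ cong₂ _⊕ᴹ_ eq (cong reference same-sites) ⟩
      untwist g′ ⊕ᴹ reference (sites g′)      ≡⟨ ⊕ᴹ-cancelʳ (reference-aligned g′∈ tg′) ⟩
      g′                                      ∎
      where
      open ≡-Reasoning
      same-sites : sites g ≡ sites g′
      same-sites = trans (sym (untwist-sites g∈ tg)) (trans (cong sites eq) (untwist-sites g′∈ tg′))

    twisted-count-< : ∀ {z} → z ∈ candidates → T (plain z) →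
      (∀ {g} → g ∈ candidates → T (twisted g) → sites g ≢ sites z) →
      length (filterᵇ twisted candidates) < length (filterᵇ plain candidates)
    twisted-count-< z∈ pz none =
      count-<-by-injection untwist (maps-unique xs yVerts-unique)
        (λ g∈ tg → untwist-∈ g∈ tg , untwist-plain g∈ tg) untwist-injective z∈ pz
        (λ g∈ tg eq → none g∈ tg (trans (sym (untwist-sites g∈ tg)) (cong sites eq)))

-- Homomorphisms from the 2-subdivision

module Subdivision (n : ℕ) (adj : Fin n → Fin n → Bool)
                   (adj-sym : ∀ u v → adj u v ≡ adj v u) (adj-irrefl : ∀ u → adj u u ≡ false)
                   (u₀ v₀ : Fin n) (e₀ : T (adj u₀ v₀)) where
  open Constructions n adj
  open Gadgets n adj
  open Untwisting subdAdj (Graph.verts G₂) (twistAt u₀ v₀)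

  trivial : SubdV → YV
  trivial (orig x)    = m x ∅ (okM-∅ x)
  trivial (mid x y e) = b x y e

  trivial-adjacent : ∀ x y → T (subdAdj x y) → T (yAdj untwisted (trivial x) (trivial y))
  trivial-adjacent x@(orig u) y@(mid _ v _) t =
    adjacent-intro {untwisted} (trivial x) (trivial y) (==-sym-T {x = u} t) (Vec.lookup-replicate v false)
  trivial-adjacent x@(mid _ v _) y@(orig u) t =
    adjacent-intro {untwisted} (trivial x) (trivial y) (==-sym-T {x = u} t) (Vec.lookup-replicate v false)
  trivial-adjacent x@(mid _ _ _) y@(mid _ _ _) t = adjacent-intro {untwisted} (trivial x) (trivial y) t refl

  trivialMap : Map
  trivialMap = graphOf trivial (Graph.verts G₂)

  trivialMap-∈ : trivialMap ∈ candidates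
  trivialMap-∈ = ∈-maps⁺ (Graph.verts G₂) ∈-yVerts (graphOf-domain trivial (Graph.verts G₂))

  trivialMap-plain : T (plain trivialMap)
  trivialMap-plain = isHom⁺ subdAdj (yAdj untwisted) trivialMap λ {x} {_} {y} x∈ y∈ xy →
    subst₂ (λ p q → T (yAdj untwisted p q)) (sym (∈-graphOf⁻ x∈)) (sym (∈-graphOf⁻ y∈)) (trivial-adjacent x y xy)

  u₀≢v₀ : u₀ ≢ v₀
  u₀≢v₀ refl = subst T (adj-irrefl u₀) e₀

  twist-adjacent : ∀ x y → T (twistAt u₀ v₀ x y) → T (adj x y)
  twist-adjacent x y t with Equivalence.to T-∨ t
  ... | inj₁ t₁ with refl , refl ← ==-sound-∧ {x = x} {u₀} {y} {v₀} t₁ = e₀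
  ... | inj₂ t₂ with refl , refl ← ==-sound-∧ {x = x} {v₀} {y} {u₀} t₂ = subst T (adj-sym u₀ v₀) e₀

  module OverTrivial {g} (g∈ : g ∈ candidates) (tg : T (twisted g)) (over : sites g ≡ sites trivialMap) where

    domain : map proj₁ g ≡ Graph.verts G₂
    domain = ∈-maps⁻ (Graph.verts G₂) yVerts g∈

    site-agrees : ∀ {x w} → (x , w) ∈ g → site w ≡ site (trivial x)
    site-agrees = agrees-with-graphOf site (subst (λ vs → sites g ≡ sites (graphOf trivial vs)) (sym domain) over)

    preserves : ∀ {x w y w′} → (x , w) ∈ g → (y , w′) ∈ g → T (subdAdj x y) → T (yAdj (twistAt u₀ v₀) w w′)
    preserves = isHom⁻ subdAdj (yAdj (twistAt u₀ v₀)) tg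

    centre-image : ∀ x → ∃₂ λ s ok → (orig x , m x s ok) ∈ g
    centre-image x =
      let w , xw∈ = image-∈ domain (orig-∈ x); s , ok , w≡ = site-centre w (site-agrees xw∈)
      in s , ok , subst (λ w → (orig x , w) ∈ g) w≡ xw∈

    S : Fin n → Subset n
    S x = proj₁ (centre-image x)

    S-ok : ∀ x → T (okM x (S x))
    S-ok x = proj₁ (proj₂ (centre-image x))

    M : Fin n → Fin n → Bool
    M x y = lookup (S x) y

    end-image : ∀ x y e → ∃ λ w → (mid x y e , w) ∈ g × site w ≡ end x y
    end-image x y e = let w , xw∈ = image-∈ domain (mid-∈ x y e) in w , xw∈ , site-agrees xw∈

    bit-of-end : ∀ x y e → isA (proj₁ (end-image x y e)) ≡ M x y
    bit-of-end x y e = let _ , w∈ , sw = end-image x y e in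
      bit-at-centre refl sw (preserves (proj₂ (proj₂ (centre-image x))) w∈ (==-refl-T x))

    skew : ∀ x y → M x y xor M y x ≡ twistAt u₀ v₀ x y
    skew x y with T? (adj x y)
    ... | yes e =
      let e′ = subst T (adj-sym x y) e; _ , w∈ , sw = end-image x y e; _ , w′∈ , sw′ = end-image y x e′ in
      trans (cong₂ _xor_ (sym (bit-of-end x y e)) (sym (bit-of-end y x e′)))
            (bits-across-edge sw sw′ (preserves w∈ w′∈ (Equivalence.from T-∧ (==-refl-T x , ==-refl-T y))))
    ... | no ¬e =
      trans (cong₂ _xor_ (okM-outside {x} {S x} (S-ok x) ¬e)
                         (okM-outside {y} {S y} (S-ok y) (¬e ∘ subst T (adj-sym y x))))
            (sym (¬T⇒≡false (¬e ∘ twist-adjacent x y)))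

    diagonal : ∀ x → M x x ≡ false
    diagonal x = okM-outside {x} {S x} (S-ok x) (subst T (adj-irrefl x))

    rows : ∀ x → ∑[ y < n ] M x y ≡ false
    rows x = okM-parity {x} {S x} (S-ok x)

  no-twisted-over-trivial : ∀ {g} → g ∈ candidates → T (twisted g) → sites g ≢ sites trivialMap
  no-twisted-over-trivial g∈ tg over = false≢true (trans (sym even) (∑∑-twisted-skew≡true M diagonal u₀≢v₀ skew))
    where
    open OverTrivial g∈ tg over
    even : ∑[ x < n ] ∑[ y < n ] M x y ≡ false
    even = trans (sum-cong-≗ rows) (sum-replicate-zero n)
    false≢true : false ≢ true
    false≢true ()

  hom-Y>hom-Ỹ : hom G₂ Y > hom G₂ (Ỹ u₀ v₀)
  hom-Y>hom-Ỹ = twisted-count-< trivialMap-∈ trivialMap-plain no-twisted-over-trivial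

theorem12p2 : (n : ℕ) (adj : Fin n → Fin n → Bool)
    → (∀ u v → adj u v ≡ adj v u)
    → (∀ u → adj u u ≡ false)
    → Connected n adj
    → 2 ≤ n
    → (u₀ v₀ : Fin n) → T (adj u₀ v₀)
    → hom (Constructions.G₂ n adj) (Constructions.Y n adj)
        > hom (Constructions.G₂ n adj) (Constructions.Ỹ n adj u₀ v₀)
theorem12p2 n adj adj-sym adj-irrefl _ _ u₀ v₀ e₀ = Subdivision.hom-Y>hom-Ỹ n adj adj-sym adj-irrefl u₀ v₀ e₀
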